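{- Let $q$ be a prime power and $d,k,r,s,t$ integers with $d$ even, $2\le d/2\le k$, $0\le r$, $k\le s+t$, and $0\le t\le\min\{k-d/2,r\}$. Let $\mathcal{B}$ be an $(s+t,\#\mathcal{B},d;k)_q$ constant-dimension code, let $\mathcal{R}\subseteq\mathbb{F}_q^{k\times(r-t)}$ be a set of matrices with pairwise rank distance at least $d/2$ and all ranks at most $k-d/2-t$, and let $W=\tau^{ -1}(0\mid I)$ be the $s$-dimensional subspace of $\mathbb{F}_q^{r+s}$ spanned by the rows of $(0\mid I)$, where $0$ is the $s\times r$ zero matrix and $I$ the $s\times s$ identity. Then $\dim(W\cap\tau^{ -1}(R\mid\tau(B)))\ge d/2$ for all $R\in\mathcal{R}$, $B\in\mathcal{B}$. In particular, $$B_q(r+s,s,d;k)\ge A_q(s+t,d;k)\cdot\Lambda(q,k,r-t,d/2,k-d/2-t).$$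
   Context: A $(v,N,d;k)_q$ constant-dimension code is a set of $N$ distinct $k$-dimensional subspaces of $\mathbb{F}_q^v$ with pairwise subspace distance $\dim(U+W)-\dim(U\cap W)$ at least $d$; $A_q(v,d;k)$ is the maximum such $N$. For $0\le w\le v$, $B_q(v,w,d;k)$ is the maximum cardinality of a $(v,N,d;k)_q$ constant-dimension code $\mathcal{B}$ for which there exists a $w$-dimensional subspace $W$ with $\dim(W\cap B)\ge d/2$ for every $B\in\mathcal{B}$. $\tau(U)$ is the reduced row echelon form basis matrix of $U$; $\tau^{ -1}(X)$ is the row space of a full-row-rank matrix $X$; $\mid$ is horizontal concatenation. $\Lambda(q,a,b,d,u)$ is the maximum size of a set of $a\times b$ matrices over $\mathbb{F}_q$ with pairwise rank distance at least $d$ and all ranks at most $u$. -}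

module Defs where

open import Level using (Level; _⊔_)
open import Data.Nat as ℕ using (ℕ; zero; suc; _≤_; _<_; _+_; _∸_; _^_)
open import Data.Nat.Properties using (m∸n+n≡m; +-assoc; +-comm)
open import Data.Nat.Primality using (Prime)
open import Data.Fin as Fin using (Fin; splitAt; cast; toℕ)
open import Data.Sum using (inj₁; inj₂)
open import Data.Product using (Σ; ∃; _×_; _,_)
open import Relation.Binary.PropositionalEquality using (_≡_; _≢_; sym; trans; cong)
open import Relation.Nullary using (¬_)
open import Relation.Binary.Definitions using (Decidable)
open import Function using (_∘_)
open import Algebra.Bundles using (CommutativeRing)

IsPrimePower : ℕ → Set
IsPrimePower q = Σ ℕ λ p → Σ ℕ λ e → Prime p × (1 ≤ e) × (q ≡ p ^ e)

colEq : (r s t : ℕ) → t ≤ r → (r ∸ t) + (s + t) ≡ r + s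
colEq r s t t≤r =
  trans (sym (+-assoc (r ∸ t) s t))
  (trans (cong (_+ t) (+-comm (r ∸ t) s))
  (trans (+-assoc s (r ∸ t) t)
  (trans (cong (s +_) (m∸n+n≡m t≤r)) (+-comm s r))))

module _ {c ℓ : Level} (F : CommutativeRing c ℓ) where
  open CommutativeRing F using (_≈_; 0#; 1#) renaming (Carrier to K; _+_ to _+ᶠ_; _*_ to _*ᶠ_; _-_ to _-ᶠ_)

  IsField : Set (c ⊔ ℓ)
  IsField = (¬ (1# ≈ 0#)) × (∀ x → ¬ (x ≈ 0#) → ∃ λ y → x *ᶠ y ≈ 1#)

  HasSize : ℕ → Set (c ⊔ ℓ)
  HasSize q = Σ (Fin q → K) λ e →
    (∀ x → ∃ λ i → e i ≈ x) × (∀ i j → e i ≈ e j → i ≡ j)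

  IsFiniteField : ℕ → Set (c ⊔ ℓ)
  IsFiniteField q = IsField × HasSize q × Decidable _≈_

  Vec : ℕ → Set c
  Vec n = Fin n → K

  Mat : ℕ → ℕ → Set c
  Mat m n = Fin m → Fin n → K

  Σᶠ : ∀ {n} → (Fin n → K) → K
  Σᶠ {zero} f = 0#
  Σᶠ {suc n} f = f Fin.zero +ᶠ Σᶠ (f ∘ Fin.suc)

  _≈ᵥ_ : ∀ {n} → Vec n → Vec n → Set ℓ
  u ≈ᵥ v = ∀ j → u j ≈ v j

  _≈ₘ_ : ∀ {m n} → Mat m n → Mat m n → Set ℓ
  A ≈ₘ B = ∀ i j → A i j ≈ B i j

  _-ₘ_ : ∀ {m n} → Mat m n → Mat m n → Mat m n
  (A -ₘ B) i j = A i j -ᶠ B i j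

  _∣ₘ_ : ∀ {m a b} → Mat m a → Mat m b → Mat m (a + b)
  (_∣ₘ_ {a = a} A B) i j with splitAt a j
  ... | inj₁ j' = A i j'
  ... | inj₂ j' = B i j'

  castCols : ∀ {m a b} → a ≡ b → Mat m a → Mat m b
  castCols eq A i j = A i (cast (sym eq) j)

  Sub : ℕ → Set (Level.suc (c ⊔ ℓ))
  Sub n = Vec n → Set (c ⊔ ℓ)

  -- τ⁻¹(X): the row space of a matrix X
  rowSpace : ∀ {m n} → Mat m n → Sub n
  rowSpace {m} X v = Σ (Fin m → K) λ a → ∀ j → v j ≈ Σᶠ (λ i → a i *ᶠ X i j)

  _∩_ : ∀ {n} → Sub n → Sub n → Sub n
  (U ∩ W) v = U v × W v

  _⊕_ : ∀ {n} → Sub n → Sub n → Sub n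
  (U ⊕ W) v = Σ (Vec _) λ u → Σ (Vec _) λ w → U u × W w × (∀ j → v j ≈ u j +ᶠ w j)

  LinIndep : ∀ {m n} → (Fin m → Vec n) → Set (c ⊔ ℓ)
  LinIndep {m} vs = ∀ (a : Fin m → K) →
    (∀ j → Σᶠ (λ i → a i *ᶠ vs i j) ≈ 0#) → ∀ i → a i ≈ 0#

  DimAtLeast : ∀ {n} → Sub n → ℕ → Set (c ⊔ ℓ)
  DimAtLeast {n} S m = Σ (Fin m → Vec n) λ vs → (∀ i → S (vs i)) × LinIndep vs

  HasDim : ∀ {n} → Sub n → ℕ → Set (c ⊔ ℓ)
  HasDim S m = DimAtLeast S m × ¬ DimAtLeast S (suc m)

  RankAtLeast : ∀ {a b} → Mat a b → ℕ → Set (c ⊔ ℓ)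
  RankAtLeast X m = DimAtLeast (rowSpace X) m

  RankAtMost : ∀ {a b} → Mat a b → ℕ → Set (c ⊔ ℓ)
  RankAtMost X u = ¬ DimAtLeast (rowSpace X) (suc u)

  SubDistAtLeast : ∀ {n} → Sub n → Sub n → ℕ → Set (c ⊔ ℓ)
  SubDistAtLeast U W d = ∀ a b → HasDim (U ⊕ W) a → HasDim (U ∩ W) b → d + b ≤ a

  IsRREF : ∀ {k n} → Mat k n → Set ℓ
  IsRREF {k} {n} X = Σ (Fin k → Fin n) λ p →
    (∀ i i' → toℕ i < toℕ i' → toℕ (p i) < toℕ (p i')) ×
    (∀ i → X i (p i) ≈ 1#) ×
    (∀ i j → toℕ j < toℕ (p i) → X i j ≈ 0#) ×
    (∀ i i' → i ≢ i' → X i' (p i) ≈ 0#)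

  -- A (v, N, d; k)_q constant-dimension code: N distinct k-dimensional subspaces of F^v,
  -- each represented by its RREF basis matrix τ(U), with pairwise subspace distance ≥ d.
  IsCDC : (v N d k : ℕ) → (Fin N → Mat k v) → Set (c ⊔ ℓ)
  IsCDC v N d k 𝓑 = (∀ i → IsRREF (𝓑 i)) ×
    (∀ i j → i ≢ j → ¬ (𝓑 i ≈ₘ 𝓑 j)) ×
    (∀ i j → i ≢ j → SubDistAtLeast (rowSpace (𝓑 i)) (rowSpace (𝓑 j)) d)

  IsAq : (v d k N : ℕ) → Set (c ⊔ ℓ)
  IsAq v d k N = (Σ (Fin N → Mat k v) λ 𝓑 → IsCDC v N d k 𝓑) ×
    (∀ M (𝓑 : Fin M → Mat k v) → IsCDC v M d k 𝓑 → M ≤ N)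

  HasBSubspace : (v w d k N : ℕ) → (Fin N → Mat k v) → Set (c ⊔ ℓ)
  HasBSubspace v w d k N 𝓑 = Σ (Mat w v) λ Wm → IsRREF Wm ×
    (∀ i → DimAtLeast (rowSpace Wm ∩ rowSpace (𝓑 i)) (d ℕ./ 2))

  IsBq : (v w d k N : ℕ) → Set (c ⊔ ℓ)
  IsBq v w d k N =
    (Σ (Fin N → Mat k v) λ 𝓑 → IsCDC v N d k 𝓑 × HasBSubspace v w d k N 𝓑) ×
    (∀ M (𝓑 : Fin M → Mat k v) → IsCDC v M d k 𝓑 → HasBSubspace v w d k M 𝓑 → M ≤ N)

  IsRankCode : (a b d u N : ℕ) → (Fin N → Mat a b) → Set (c ⊔ ℓ)
  IsRankCode a b d u N 𝓡 =
    (∀ i j → i ≢ j → ¬ (𝓡 i ≈ₘ 𝓡 j)) ×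
    (∀ i j → i ≢ j → RankAtLeast (𝓡 i -ₘ 𝓡 j) d) ×
    (∀ i → RankAtMost (𝓡 i) u)

  IsΛ : (a b d u N : ℕ) → Set (c ⊔ ℓ)
  IsΛ a b d u N = (Σ (Fin N → Mat a b) λ 𝓡 → IsRankCode a b d u N 𝓡) ×
    (∀ M (𝓡 : Fin M → Mat a b) → IsRankCode a b d u M 𝓡 → M ≤ N)

  zeroId : (m s : ℕ) → Mat s (m + s)
  zeroId m s i j with splitAt m j
  ... | inj₁ _ = 0#
  ... | inj₂ j' with i Fin.≟ j'
  ...   | Relation.Nullary.yes _ = 1#
  ...   | Relation.Nullary.no _ = 0#

-- Put X = (R ∣ τ(B)) and let W be spanned by the unit vectors on the last s coordinates. The row xX lies
-- in W as soon as x ∈ F^k annihilates R and the first t columns of τ(B); since rank R ≤ k − d/2 − t, these x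
-- form a space of dimension ≥ d/2 by rank–nullity, and x ↦ xX is injective because τ(B) has independent rows.
--
-- For the bound, the matrices (τ(B) ∣ R) with the blocks swapped are in reduced row echelon form and form a
-- constant-dimension code of size A_q(s+t,d;k)·Λ. For different B, restricting to the columns of B is injective
-- on both row spaces and maps their sum onto the sum of the row spaces of the B's, so the distance is at least
-- that of the B's. For the same B, every vector of the intersection has a coefficient vector in the left kernel
-- of D = R − R′, while the sum contains the k rows of X and rank D vectors of the form (0 ∣ yD); hence the
-- distance is at least 2 · rank D ≥ d.

module Submission where

open import Defs
open import Level using (Level; _⊔_; Lift; lift; lower)
open import Algebra.Bundles using (CommutativeRing)
open import Data.Nat using (ℕ; zero; suc; _≤_; _<_; _+_; _∸_; _*_; _/_; z≤n; s≤s)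
import Data.Nat.Properties as ℕ
import Data.Nat.DivMod as DivMod
open import Data.Nat.Divisibility using (_∣_)
open import Data.Fin using (Fin; zero; suc; splitAt; _↑ˡ_; _↑ʳ_; toℕ)
import Data.Fin as Fin
import Data.Fin.Properties as Fin
open import Data.Sum using (_⊎_; inj₁; inj₂)
import Data.Sum
open import Data.Product using (Σ; ∃; _×_; _,_; proj₁; proj₂; uncurry)
open import Relation.Binary.Definitions using (DecidableEquality)
open import Relation.Binary.PropositionalEquality as ≡ using (_≡_; _≢_)
open import Function using (_∘_)
open import Data.Vec.Functional using (_++_; _∷_)
import Data.Vec.Functional.Properties as Vecᶠ
open import Data.Bool using (if_then_else_)
open import Relation.Nullary.Decidable using (does; dec-true; dec-false; map′; decidable-stable)
open import Relation.Nullary using (¬_; Dec; yes; no)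
open import Data.Empty using (⊥; ⊥-elim)

+-double-≤ : ∀ {b h k a} → b + h ≤ k → k + h ≤ a → h + h + b ≤ a
+-double-≤ {b} {h} {k} {a} b+h≤k k+h≤a = begin
  h + h + b   ≡⟨ ≡.trans (ℕ.+-assoc h h b) (≡.cong (h +_) (ℕ.+-comm h b)) ⟩
  h + (b + h) ≤⟨ ℕ.+-monoʳ-≤ h b+h≤k ⟩
  h + k       ≡⟨ ℕ.+-comm h k ⟩
  k + h       ≤⟨ k+h≤a ⟩
  a           ∎
  where open ℕ.≤-Reasoning

×-≢ : ∀ {a b} {A : Set a} {B : Set b} → DecidableEquality A → {p q : A × B} → p ≢ q →
  proj₁ p ≢ proj₁ q ⊎ (proj₁ p ≡ proj₁ q × proj₂ p ≢ proj₂ q)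
×-≢ _≟_ {p₁ , _} {q₁ , _} p≢q with p₁ ≟ q₁
... | no p₁≢q₁ = inj₁ p₁≢q₁
... | yes ≡.refl = inj₂ (≡.refl , λ p₂≡q₂ → p≢q (≡.cong (p₁ ,_) p₂≡q₂))

remQuot-injective : ∀ {m} n {x y : Fin (m * n)} → Fin.remQuot {m} n x ≡ Fin.remQuot n y → x ≡ y
remQuot-injective {m} n {x} {y} eq =
  ≡.trans (≡.sym (Fin.combine-remQuot {m} n x)) (≡.trans (≡.cong (uncurry Fin.combine) eq) (Fin.combine-remQuot {m} n y))

m+n+[o∸m∸n]≡o : ∀ {m n o} → m ≤ o → n ≤ o ∸ m → m + n + (o ∸ m ∸ n) ≡ o
m+n+[o∸m∸n]≡o {m} {n} {o} m≤o n≤o∸m =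
  ≡.trans (ℕ.+-assoc m n (o ∸ m ∸ n)) (≡.trans (≡.cong (m +_) (ℕ.m+[n∸m]≡n n≤o∸m)) (ℕ.m+[n∸m]≡n m≤o))

half+half : ∀ {d} → 2 ∣ d → d / 2 + d / 2 ≡ d
half+half {d} 2∣d = begin
  d / 2 + d / 2       ≡⟨ ≡.cong (d / 2 +_) (ℕ.+-identityʳ (d / 2)) ⟨
  2 * (d / 2)         ≡⟨ ℕ.*-comm 2 (d / 2) ⟩
  d / 2 * 2           ≡⟨ DivMod.m/n*n≡m 2∣d ⟩
  d                   ∎
  where open ≡.≡-Reasoning

record ColumnSplit (a b n : ℕ) : Set where
  field
    left : Fin a → Fin n
    right : Fin b → Fin n
    covers : ∀ col → (∃ λ j → left j ≡ col) ⊎ (∃ λ j → right j ≡ col)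

castSplit : ∀ {a b n} → a + b ≡ n → ColumnSplit a b n
castSplit {a} {b} eq = record
  { left = λ j → Fin.cast eq (j ↑ˡ b)
  ; right = λ j → Fin.cast eq (a ↑ʳ j)
  ; covers = covers
  }
  where
  uncast : ∀ {ι col} → ι ≡ Fin.cast (≡.sym eq) col → Fin.cast eq ι ≡ col
  uncast {col = col} ≡.refl = Fin.cast-involutive eq (≡.sym eq) col
  covers : ∀ col → (∃ λ j → Fin.cast eq (j ↑ˡ b) ≡ col) ⊎ (∃ λ j → Fin.cast eq (a ↑ʳ j) ≡ col)
  covers col with splitAt a (Fin.cast (≡.sym eq) col) in split≡
  ... | inj₁ j = inj₁ (j , uncast (Fin.splitAt⁻¹-↑ˡ split≡))
  ... | inj₂ j = inj₂ (j , uncast (Fin.splitAt⁻¹-↑ʳ split≡))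

toℕ-castSplit-left : ∀ {a b n} (eq : a + b ≡ n) j → toℕ (ColumnSplit.left (castSplit eq) j) ≡ toℕ j
toℕ-castSplit-left {b = b} eq j = ≡.trans (Fin.toℕ-cast eq (j ↑ˡ b)) (Fin.toℕ-↑ˡ j b)

toℕ-castSplit-right : ∀ {a b n} (eq : a + b ≡ n) j → toℕ (ColumnSplit.right (castSplit eq) j) ≡ a + toℕ j
toℕ-castSplit-right {a} eq j = ≡.trans (Fin.toℕ-cast eq (a ↑ʳ j)) (Fin.toℕ-↑ʳ a j)

swapSplit : ∀ {a b n} → ColumnSplit a b n → ColumnSplit b a n
swapSplit σ = record { left = right ; right = left ; covers = Data.Sum.swap ∘ covers }
  where open ColumnSplit σ

record Juxtaposed {c} {A : Set c} {k a b n} (σ : ColumnSplit a b n)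
  (X : Fin k → Fin n → A) (L : Fin k → Fin a → A) (R : Fin k → Fin b → A) : Set c where
  field
    left-cols : ∀ i j → X i (ColumnSplit.left σ j) ≡ L i j
    right-cols : ∀ i j → X i (ColumnSplit.right σ j) ≡ R i j

swapJuxtaposed : ∀ {c} {A : Set c} {k a b n} {σ : ColumnSplit a b n} {X : Fin k → Fin n → A} {L R} →
  Juxtaposed σ X L R → Juxtaposed (swapSplit σ) X R L
swapJuxtaposed J = record { left-cols = right-cols ; right-cols = left-cols }
  where open Juxtaposed J

castCols-juxtaposed : ∀ {c ℓ} (F : CommutativeRing c ℓ) {k a b n} (eq : a + b ≡ n) (L : Mat F k a) (R : Mat F k b) →
  Juxtaposed (castSplit eq) (castCols F eq (_∣ₘ_ F L R)) L R
castCols-juxtaposed F {a = a} {b} eq L R = record { left-cols = left-col ; right-cols = right-col }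
  where
  left-col : ∀ i j → castCols F eq (_∣ₘ_ F L R) i (Fin.cast eq (j ↑ˡ b)) ≡ L i j
  left-col i j rewrite Fin.cast-involutive (≡.sym eq) eq (j ↑ˡ b) | Fin.splitAt-↑ˡ a j b = ≡.refl
  right-col : ∀ i j → castCols F eq (_∣ₘ_ F L R) i (Fin.cast eq (a ↑ʳ j)) ≡ R i j
  right-col i j rewrite Fin.cast-involutive (≡.sym eq) eq (a ↑ʳ j) | Fin.splitAt-↑ʳ a b j = ≡.refl

tailSplit : ∀ s t → ColumnSplit t s (s + t)
tailSplit s t = castSplit (ℕ.+-comm t s)

↑ʳ≡right∘right : ∀ {r s t} (t≤r : t ≤ r) (i : Fin s) →
  r ↑ʳ i ≡ ColumnSplit.right (castSplit {r ∸ t} {s + t} (colEq r s t t≤r)) (ColumnSplit.right (tailSplit s t) i)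
↑ʳ≡right∘right {r} {s} {t} t≤r i = Fin.toℕ-injective (begin
  toℕ (r ↑ʳ i)                    ≡⟨ Fin.toℕ-↑ʳ r i ⟩
  r + toℕ i                       ≡⟨ ≡.cong (_+ toℕ i) (ℕ.m∸n+n≡m t≤r) ⟨
  r ∸ t + t + toℕ i               ≡⟨ ℕ.+-assoc (r ∸ t) t (toℕ i) ⟩
  r ∸ t + (t + toℕ i)             ≡⟨ ≡.cong (r ∸ t +_) (toℕ-castSplit-right (ℕ.+-comm t s) i) ⟨
  r ∸ t + toℕ (right τ i)         ≡⟨ toℕ-castSplit-right (colEq r s t t≤r) (right τ i) ⟨
  toℕ (right σ (right τ i))       ∎)
  where
  open ColumnSplit
  open ≡.≡-Reasoning
  σ : ColumnSplit (r ∸ t) (s + t) (r + s)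
  σ = castSplit (colEq r s t t≤r)
  τ : ColumnSplit t s (s + t)
  τ = tailSplit s t

module LinearCombinations {c ℓ : Level} (F : CommutativeRing c ℓ) where
  open CommutativeRing F renaming (Carrier to K; _+_ to _⊹_; _*_ to _·_; zero to ·-zero)
  open import Algebra.Properties.Ring ring using (-1*x≈-x; -‿distribˡ-*; x[y-z]≈xy-xz)
  open import Algebra.Properties.Semiring.Sum semiring
    using (sum; sum-cong-≋; sum-replicate-zero; ∑-distrib-+; *-distribˡ-sum)
  open import Relation.Binary.Reasoning.Setoid setoid
  open ColumnSplit

  V : ℕ → Set c
  V = Vec F

  M : ℕ → ℕ → Set c
  M = Mat F

  Σᶠ≡sum : ∀ {n} (f : V n) → Σᶠ F f ≡ sum f
  Σᶠ≡sum {zero} f = ≡.refl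
  Σᶠ≡sum {suc n} f = ≡.cong (f zero ⊹_) (Σᶠ≡sum (f ∘ suc))

  Σᶠ-cong : ∀ {n} {f g : V n} → (∀ i → f i ≈ g i) → Σᶠ F f ≈ Σᶠ F g
  Σᶠ-cong {f = f} {g} f≈g rewrite Σᶠ≡sum f | Σᶠ≡sum g = sum-cong-≋ f≈g

  Σᶠ-zero : ∀ {n} {f : V n} → (∀ i → f i ≈ 0#) → Σᶠ F f ≈ 0#
  Σᶠ-zero {n} {f} f≈0 rewrite Σᶠ≡sum f = trans (sum-cong-≋ f≈0) (sum-replicate-zero n)

  Σᶠ-distrib-+ : ∀ {n} (f g : V n) → Σᶠ F (λ i → f i ⊹ g i) ≈ Σᶠ F f ⊹ Σᶠ F g
  Σᶠ-distrib-+ f g rewrite Σᶠ≡sum (λ i → f i ⊹ g i) | Σᶠ≡sum f | Σᶠ≡sum g = ∑-distrib-+ f g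

  *-distribˡ-Σᶠ : ∀ {n} x (f : V n) → x · Σᶠ F f ≈ Σᶠ F (λ i → x · f i)
  *-distribˡ-Σᶠ x f rewrite Σᶠ≡sum f | Σᶠ≡sum (λ i → x · f i) = *-distribˡ-sum x f

  Σᶠ-comm : ∀ {m n} (f : Fin m → Fin n → K) →
    Σᶠ F (λ i → Σᶠ F (f i)) ≈ Σᶠ F (λ j → Σᶠ F (λ i → f i j))
  Σᶠ-comm {zero} {n} f = sym (Σᶠ-zero {n} (λ _ → refl))
  Σᶠ-comm {suc m} f = trans (+-congˡ (Σᶠ-comm (f ∘ suc))) (sym (Σᶠ-distrib-+ (f zero) _))

  -‿Σᶠ : ∀ {n} (f : V n) → - Σᶠ F f ≈ Σᶠ F (λ i → - f i)
  -‿Σᶠ f = begin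
    - Σᶠ F f                  ≈⟨ -1*x≈-x _ ⟨
    - 1# · Σᶠ F f             ≈⟨ *-distribˡ-Σᶠ (- 1#) f ⟩
    Σᶠ F (λ i → - 1# · f i)   ≈⟨ Σᶠ-cong (λ i → -1*x≈-x (f i)) ⟩
    Σᶠ F (λ i → - f i)        ∎

  Σᶠ-single : ∀ {n} (f : V n) i → (∀ i′ → i′ ≢ i → f i′ ≈ 0#) → Σᶠ F f ≈ f i
  Σᶠ-single {suc n} f zero f≈0 = trans (+-congˡ (Σᶠ-zero (λ i′ → f≈0 (suc i′) λ ()))) (+-identityʳ _)
  Σᶠ-single {suc n} f (suc i) f≈0 = begin
    f zero ⊹ Σᶠ F (f ∘ suc)  ≈⟨ +-cong (f≈0 zero λ ())
                                  (Σᶠ-single (f ∘ suc) i (λ i′ i′≢i → f≈0 (suc i′) (i′≢i ∘ Fin.suc-injective))) ⟩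
    0# ⊹ f (suc i)           ≈⟨ +-identityˡ _ ⟩
    f (suc i)                ∎

  Σᶠ-++ : ∀ {a b} (f : V (a + b)) → Σᶠ F f ≈ Σᶠ F (λ i → f (i ↑ˡ b)) ⊹ Σᶠ F (λ i → f (a ↑ʳ i))
  Σᶠ-++ {zero} f = sym (+-identityˡ _)
  Σᶠ-++ {suc a} {b} f = trans (+-congˡ (Σᶠ-++ {a} {b} (f ∘ suc))) (sym (+-assoc _ _ _))

  infixl 8 _*ₘ_
  infixl 7 _⋆_

  _⋆_ : ∀ {m n} → V m → M m n → V n
  (a ⋆ X) j = Σᶠ F (λ i → a i · X i j)

  _*ₘ_ : ∀ {k m n} → M k m → M m n → M k n
  (G *ₘ X) l = G l ⋆ X

  ⋆-congˡ : ∀ {m n} {a b : V m} (X : M m n) → (∀ i → a i ≈ b i) → ∀ j → (a ⋆ X) j ≈ (b ⋆ X) j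
  ⋆-congˡ X a≈b j = Σᶠ-cong (λ i → *-congʳ (a≈b i))

  ⋆-congʳ : ∀ {m n} (a : V m) {X Y : M m n} → (∀ i j → X i j ≈ Y i j) → ∀ j → (a ⋆ X) j ≈ (a ⋆ Y) j
  ⋆-congʳ a X≈Y j = Σᶠ-cong (λ i → *-congˡ (X≈Y i j))

  ⋆-zeroˡ : ∀ {m n} {a : V m} (X : M m n) → (∀ i → a i ≈ 0#) → ∀ j → (a ⋆ X) j ≈ 0#
  ⋆-zeroˡ X a≈0 j = Σᶠ-zero (λ i → trans (*-congʳ (a≈0 i)) (zeroˡ _))

  ⋆-zeroʳ : ∀ {m n} (a : V m) {X : M m n} j → (∀ i → X i j ≈ 0#) → (a ⋆ X) j ≈ 0#
  ⋆-zeroʳ a j X≈0 = Σᶠ-zero (λ i → trans (*-congˡ (X≈0 i)) (zeroʳ _))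

  ⋆-distribʳ-⊹ : ∀ {m n} (a b : V m) (X : M m n) j → ((λ i → a i ⊹ b i) ⋆ X) j ≈ (a ⋆ X) j ⊹ (b ⋆ X) j
  ⋆-distribʳ-⊹ a b X j =
    trans (Σᶠ-cong (λ i → distribʳ (X i j) (a i) (b i))) (Σᶠ-distrib-+ (λ i → a i · X i j) (λ i → b i · X i j))

  ⋆-neg : ∀ {m n} (a : V m) (X : M m n) j → ((λ i → - a i) ⋆ X) j ≈ - (a ⋆ X) j
  ⋆-neg a X j = trans (Σᶠ-cong (λ i → sym (-‿distribˡ-* (a i) (X i j)))) (sym (-‿Σᶠ (λ i → a i · X i j)))

  ⋆-distribʳ-- : ∀ {m n} (a b : V m) (X : M m n) j → ((λ i → a i - b i) ⋆ X) j ≈ (a ⋆ X) j - (b ⋆ X) j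
  ⋆-distribʳ-- a b X j = trans (⋆-distribʳ-⊹ a (λ i → - b i) X j) (+-congˡ (⋆-neg b X j))

  ⋆-distribˡ--ₘ : ∀ {m n} (a : V m) (X Y : M m n) j → (a ⋆ _-ₘ_ F X Y) j ≈ (a ⋆ X) j - (a ⋆ Y) j
  ⋆-distribˡ--ₘ a X Y j = begin
    (a ⋆ _-ₘ_ F X Y) j                                   ≈⟨ Σᶠ-cong (λ i → x[y-z]≈xy-xz (a i) (X i j) (Y i j)) ⟩
    Σᶠ F (λ i → a i · X i j ⊹ - (a i · Y i j))           ≈⟨ Σᶠ-distrib-+ (λ i → a i · X i j) (λ i → - (a i · Y i j)) ⟩
    (a ⋆ X) j ⊹ Σᶠ F (λ i → - (a i · Y i j))             ≈⟨ +-congˡ (-‿Σᶠ (λ i → a i · Y i j)) ⟨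
    (a ⋆ X) j - (a ⋆ Y) j                                ∎

  ⋆-scale : ∀ {m n} x (a : V m) (X : M m n) j → ((λ i → x · a i) ⋆ X) j ≈ x · (a ⋆ X) j
  ⋆-scale x a X j = trans (Σᶠ-cong (λ i → *-assoc x (a i) (X i j))) (sym (*-distribˡ-Σᶠ x (λ i → a i · X i j)))

  ⋆-assoc : ∀ {k m n} (a : V k) (G : M k m) (X : M m n) j → (a ⋆ (G *ₘ X)) j ≈ ((a ⋆ G) ⋆ X) j
  ⋆-assoc a G X j = begin
    Σᶠ F (λ l → a l · Σᶠ F (λ i → G l i · X i j))    ≈⟨ Σᶠ-cong (λ l → *-distribˡ-Σᶠ (a l) (λ i → G l i · X i j)) ⟩
    Σᶠ F (λ l → Σᶠ F (λ i → a l · (G l i · X i j)))  ≈⟨ Σᶠ-comm (λ l i → a l · (G l i · X i j)) ⟩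
    Σᶠ F (λ i → Σᶠ F (λ l → a l · (G l i · X i j)))  ≈⟨ Σᶠ-cong (λ i → Σᶠ-cong (λ l → *-assoc (a l) (G l i) (X i j))) ⟨
    Σᶠ F (λ i → Σᶠ F (λ l → (a l · G l i) · X i j))  ≈⟨ Σᶠ-cong (λ i → *-distribʳ-Σᶠ (X i j) (λ l → a l · G l i)) ⟨
    Σᶠ F (λ i → (a ⋆ G) i · X i j)                   ∎
    where
    *-distribʳ-Σᶠ : ∀ {n} x (f : V n) → Σᶠ F f · x ≈ Σᶠ F (λ i → f i · x)
    *-distribʳ-Σᶠ x f = trans (*-comm _ x) (trans (*-distribˡ-Σᶠ x f) (Σᶠ-cong (λ i → *-comm x (f i))))

  Indep : ∀ {m n} → M m n → Set (c ⊔ ℓ)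
  Indep = LinIndep F

  Indep-resp : ∀ {m n} {X Y : M m n} → (∀ i j → X i j ≈ Y i j) → Indep X → Indep Y
  Indep-resp X≈Y indX a aY≈0 = indX a (λ j → trans (⋆-congʳ a X≈Y j) (aY≈0 j))

  Indep-*ₘ : ∀ {k m n} {G : M k m} {X : M m n} → Indep G → Indep X → Indep (G *ₘ X)
  Indep-*ₘ {G = G} {X} indG indX a aGX≈0 = indG a (indX (a ⋆ G) (λ j → trans (sym (⋆-assoc a G X j)) (aGX≈0 j)))

  Indep-coefficients : ∀ {b k n} {Z : M b n} (A : M b k) (X : M k n) →
    (∀ l j → Z l j ≈ (A l ⋆ X) j) → Indep Z → Indep A
  Indep-coefficients {Z = Z} A X Z≈AX indZ a aA≈0 = indZ a (λ j → begin
    (a ⋆ Z) j        ≈⟨ ⋆-congʳ a Z≈AX j ⟩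
    (a ⋆ A *ₘ X) j   ≈⟨ ⋆-assoc a A X j ⟩
    ((a ⋆ A) ⋆ X) j  ≈⟨ ⋆-zeroˡ X aA≈0 j ⟩
    0#               ∎)

  Indep-columns : ∀ {k n n′} (X : M k n) (Y : M k n′) (col : Fin n′ → Fin n) →
    (∀ i j → X i (col j) ≈ Y i j) → Indep Y → Indep X
  Indep-columns X Y col X≈Y indY a aX≈0 = indY a (λ j → trans (sym (⋆-congʳ a X≈Y j)) (aX≈0 (col j)))

  ↑-elim : ∀ {p a b} (P : Fin (a + b) → Set p) → (∀ i → P (i ↑ˡ b)) → (∀ j → P (a ↑ʳ j)) → ∀ ι → P ι
  ↑-elim {a = a} P Pˡ Pʳ ι with splitAt a ι in eq
  ... | inj₁ i = ≡.subst P (Fin.splitAt⁻¹-↑ˡ eq) (Pˡ i)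
  ... | inj₂ j = ≡.subst P (Fin.splitAt⁻¹-↑ʳ eq) (Pʳ j)

  ⋆-++ : ∀ {a b n} (α : V (a + b)) (X : M a n) (Y : M b n) j →
    (α ⋆ (X ++ Y)) j ≈ ((α ∘ (_↑ˡ b)) ⋆ X) j ⊹ ((α ∘ (a ↑ʳ_)) ⋆ Y) j
  ⋆-++ {a} {b} α X Y j = trans (Σᶠ-++ {a} {b} (λ ι → α ι · (X ++ Y) ι j))
    (+-cong (Σᶠ-cong (λ i → *-congˡ (reflexive (≡.cong (λ row → row j) (Vecᶠ.lookup-++ˡ X Y i)))))
            (Σᶠ-cong (λ i → *-congˡ (reflexive (≡.cong (λ row → row j) (Vecᶠ.lookup-++ʳ X Y i))))))

  Indep-++ : ∀ {a b n} (X : M a n) (Y : M b n) →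
    (∀ (α : V a) (β : V b) → (∀ j → (α ⋆ X) j ⊹ (β ⋆ Y) j ≈ 0#) → (∀ i → α i ≈ 0#) × (∀ i → β i ≈ 0#)) →
    Indep (X ++ Y)
  Indep-++ {a} {b} X Y split γ γXY≈0 =
    ↑-elim (λ ι → γ ι ≈ 0#) (proj₁ γ≈0) (proj₂ γ≈0)
    where
    γ≈0 : (∀ i → γ (i ↑ˡ b) ≈ 0#) × (∀ j → γ (a ↑ʳ j) ≈ 0#)
    γ≈0 = split (γ ∘ (_↑ˡ b)) (γ ∘ (a ↑ʳ_)) (λ j → trans (sym (⋆-++ γ X Y j)) (γXY≈0 j))

  ∀-++ : ∀ {p a b n} (P : V n → Set p) (X : M a n) (Y : M b n) →
    (∀ i → P (X i)) → (∀ i → P (Y i)) → ∀ ι → P ((X ++ Y) ι)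
  ∀-++ {a = a} P X Y PX PY ι with splitAt a ι
  ... | inj₁ i = PX i
  ... | inj₂ i = PY i

  Indep-↑ˡ : ∀ {a b n} (X : M (a + b) n) → Indep X → Indep (X ∘ (_↑ˡ b))
  Indep-↑ˡ {a} {b} X indX α αX≈0 i = begin
    α i                            ≡⟨ Vecᶠ.lookup-++ˡ α zeros i ⟨
    (α ++ zeros) (i ↑ˡ b)             ≈⟨ indX (α ++ zeros) padded≈0 (i ↑ˡ b) ⟩
    0#                             ∎
    where
    zeros : V b
    zeros _ = 0#
    padded≈0 : ∀ j → ((α ++ zeros) ⋆ X) j ≈ 0#
    padded≈0 j = begin
      ((α ++ zeros) ⋆ X) j                                                        ≈⟨ Σᶠ-++ {a} {b} (λ ι → (α ++ zeros) ι · X ι j) ⟩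
      Σᶠ F (λ i → (α ++ zeros) (i ↑ˡ b) · X (i ↑ˡ b) j) ⊹ Σᶠ F (λ i → (α ++ zeros) (a ↑ʳ i) · X (a ↑ʳ i) j)
        ≈⟨ +-cong (Σᶠ-cong (λ i → *-congʳ (reflexive (Vecᶠ.lookup-++ˡ α zeros i))))
                  (Σᶠ-zero (λ i → trans (*-congʳ (reflexive (Vecᶠ.lookup-++ʳ α zeros i))) (zeroˡ _))) ⟩
      (α ⋆ (X ∘ (_↑ˡ b))) j ⊹ 0#                                               ≈⟨ +-identityʳ _ ⟩
      (α ⋆ (X ∘ (_↑ˡ b))) j                                                    ≈⟨ αX≈0 j ⟩
      0#                                                                       ∎

  DimAtLeast-≤ : ∀ {n} {S : Sub F n} {d e} → e ≤ d → DimAtLeast F S d → DimAtLeast F S e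
  DimAtLeast-≤ {S = S} e≤d dimS with ℕ.m≤n⇒∃[o]m+o≡n e≤d
  ... | o , ≡.refl with dimS
  ...   | vs , vs∈S , indVs = vs ∘ (_↑ˡ o) , vs∈S ∘ (_↑ˡ o) , Indep-↑ˡ vs indVs

  IsRREF⇒Indep : ∀ {k n} (X : M k n) → IsRREF F X → Indep X
  IsRREF⇒Indep X (p , _ , pivot≈1 , _ , column≈0) a aX≈0 i = begin
    a i                 ≈⟨ *-identityʳ _ ⟨
    a i · 1#            ≈⟨ *-congˡ (pivot≈1 i) ⟨
    a i · X i (p i)     ≈⟨ Σᶠ-single (λ i′ → a i′ · X i′ (p i)) i
                             (λ i′ i′≢i → trans (*-congˡ (column≈0 i i′ (i′≢i ∘ ≡.sym))) (zeroʳ _)) ⟨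
    (a ⋆ X) (p i)       ≈⟨ aX≈0 (p i) ⟩
    0#                  ∎

  row∈rowSpace : ∀ {m n} (X : M m n) i → rowSpace F X (X i)
  row∈rowSpace X i = δ , λ j → sym (begin
    (δ ⋆ X) j   ≈⟨ Σᶠ-single (λ i′ → δ i′ · X i′ j) i (λ i′ i′≢i → trans (*-congʳ (δ-off i′≢i)) (zeroˡ _)) ⟩
    δ i · X i j ≈⟨ *-congʳ δ-on ⟩
    1# · X i j  ≈⟨ *-identityˡ _ ⟩
    X i j       ∎)
    where
    δ : V _
    δ i′ = if does (i′ Fin.≟ i) then 1# else 0#
    δ-off : ∀ {i′} → i′ ≢ i → δ i′ ≈ 0#
    δ-off {i′} i′≢i rewrite dec-false (i′ Fin.≟ i) i′≢i = refl
    δ-on : δ i ≈ 1#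
    δ-on rewrite dec-true (i Fin.≟ i) ≡.refl = refl

  LeftKernel : ∀ {m n} → M m n → Sub F m
  LeftKernel N a = Lift c (∀ j → (a ⋆ N) j ≈ 0#)

  ⋆-left : ∀ {k a b n} {σ : ColumnSplit a b n} {X : M k n} {L : M k a} {R : M k b} →
    Juxtaposed σ X L R → ∀ x j → (x ⋆ X) (left σ j) ≈ (x ⋆ L) j
  ⋆-left J x j = Σᶠ-cong (λ i → *-congˡ (reflexive (Juxtaposed.left-cols J i j)))

  ⋆-right : ∀ {k a b n} {σ : ColumnSplit a b n} {X : M k n} {L : M k a} {R : M k b} →
    Juxtaposed σ X L R → ∀ x j → (x ⋆ X) (right σ j) ≈ (x ⋆ R) j
  ⋆-right J x j = Σᶠ-cong (λ i → *-congˡ (reflexive (Juxtaposed.right-cols J i j)))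

  record UnitRows {s n} (W : M s n) : Set (c ⊔ ℓ) where
    field
      pivot : Fin s → Fin n
      pivot-injective : ∀ {i i′} → pivot i ≡ pivot i′ → i ≡ i′
      at-pivot : ∀ i → W i (pivot i) ≈ 1#
      off-pivot : ∀ i {col} → col ≢ pivot i → W i col ≈ 0#

    span : (v : V n) → (∀ col → (∀ i → col ≢ pivot i) → v col ≈ 0#) → rowSpace F W v
    span v v≈0 = v ∘ pivot , v≈vW
      where
      v≈vW : ∀ col → v col ≈ ((v ∘ pivot) ⋆ W) col
      v≈vW col with Fin.any? (λ i → col Fin.≟ pivot i)
      ... | yes (i , ≡.refl) = sym (begin
        ((v ∘ pivot) ⋆ W) (pivot i)  ≈⟨ Σᶠ-single (λ i′ → v (pivot i′) · W i′ (pivot i)) i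
                                          (λ i′ i′≢i → trans (*-congˡ (off-pivot i′ (i′≢i ∘ pivot-injective ∘ ≡.sym))) (zeroʳ _)) ⟩
        v (pivot i) · W i (pivot i)  ≈⟨ *-congˡ (at-pivot i) ⟩
        v (pivot i) · 1#             ≈⟨ *-identityʳ _ ⟩
        v (pivot i)                  ∎)
      ... | no ¬pivot = trans (v≈0 col (λ i col≡ → ¬pivot (i , col≡)))
                              (sym (⋆-zeroʳ (v ∘ pivot) {W} col (λ i → off-pivot i (λ col≡ → ¬pivot (i , col≡)))))

  zeroId-unitRows : ∀ m s → UnitRows (zeroId F m s)
  zeroId-unitRows m s = record
    { pivot = m ↑ʳ_ ; pivot-injective = Fin.↑ʳ-injective m _ _ ; at-pivot = at-pivot ; off-pivot = off-pivot }
    where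
    at-pivot : ∀ i → zeroId F m s i (m ↑ʳ i) ≈ 1#
    at-pivot i rewrite Fin.splitAt-↑ʳ m s i with i Fin.≟ i
    ... | yes _ = refl
    ... | no i≢i = ⊥-elim (i≢i ≡.refl)
    off-pivot : ∀ i {col} → col ≢ m ↑ʳ i → zeroId F m s i col ≈ 0#
    off-pivot i {col} col≢ with splitAt m col in split≡
    ... | inj₁ _ = refl
    ... | inj₂ j with i Fin.≟ j
    ...   | no _ = refl
    ...   | yes ≡.refl = ⊥-elim (col≢ (≡.sym (Fin.splitAt⁻¹-↑ʳ split≡)))

  firstCols : ∀ {k s} t → M k (s + t) → M k t
  firstCols {s = s} t B i j = B i (left (tailSplit s t) j)

  vanish-off-pivots : ∀ {k s t a n} {X : M k n} {B : M k (s + t)} {R : M k a} {W : M s n}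
    (σ : ColumnSplit (s + t) a n) → Juxtaposed σ X B R → (U : UnitRows W) →
    (∀ i → UnitRows.pivot U i ≡ left σ (right (tailSplit s t) i)) →
    ∀ {x} → LeftKernel R x → LeftKernel (firstCols t B) x →
    ∀ col → (∀ i → col ≢ UnitRows.pivot U i) → (x ⋆ X) col ≈ 0#
  vanish-off-pivots {s = s} {t} σ J U pivot≡ {x} (lift xR≈0) (lift xBₜ≈0) col not-pivot
    with covers σ col
  ... | inj₂ (j , ≡.refl) = trans (⋆-right J x j) (xR≈0 j)
  ... | inj₁ (c , ≡.refl) with covers (tailSplit s t) c
  ...   | inj₁ (j , ≡.refl) = trans (⋆-left J x (left (tailSplit s t) j)) (xBₜ≈0 j)
  ...   | inj₂ (i , ≡.refl) = ⊥-elim (not-pivot i (≡.sym (pivot≡ i)))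

  unitMatrix : ∀ {s n} → (Fin s → Fin n) → M s n
  unitMatrix p i col = if does (col Fin.≟ p i) then 1# else 0#

  unitMatrix-unitRows : ∀ {s n} (p : Fin s → Fin n) → (∀ {i i′} → p i ≡ p i′ → i ≡ i′) → UnitRows (unitMatrix p)
  unitMatrix-unitRows p p-injective = record
    { pivot = p ; pivot-injective = p-injective ; at-pivot = at-pivot ; off-pivot = off-pivot }
    where
    at-pivot : ∀ i → unitMatrix p i (p i) ≈ 1#
    at-pivot i rewrite dec-true (p i Fin.≟ p i) ≡.refl = refl
    off-pivot : ∀ i {col} → col ≢ p i → unitMatrix p i col ≈ 0#
    off-pivot i {col} col≢ rewrite dec-false (col Fin.≟ p i) col≢ = refl

  unitMatrix-isRREF : ∀ {s n} (p : Fin s → Fin n) → (∀ {i i′} → p i ≡ p i′ → i ≡ i′) →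
    (∀ i i′ → toℕ i < toℕ i′ → toℕ (p i) < toℕ (p i′)) → IsRREF F (unitMatrix p)
  unitMatrix-isRREF p p-injective p-mono =
    p , p-mono , at-pivot , (λ i col col<p → off-pivot i (λ col≡ → ℕ.<-irrefl (≡.cong toℕ col≡) col<p)) ,
    (λ i i′ i≢i′ → off-pivot i′ (i≢i′ ∘ p-injective))
    where open UnitRows (unitMatrix-unitRows p p-injective)

  IsRREF-castCols : ∀ {k a b n} (eq : a + b ≡ n) (B : M k a) (R : M k b) → IsRREF F B →
    IsRREF F (castCols F eq (_∣ₘ_ F B R))
  IsRREF-castCols {a = a} {b} {n} eq B R (p , p-mono , at-p , before-p , beside-p) =
    left σ ∘ p , mono , (λ i → trans (reflexive (X-B i (p i))) (at-p i)) , before ,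
    (λ i i′ i≢i′ → trans (reflexive (X-B i′ (p i))) (beside-p i i′ i≢i′))
    where
    σ : ColumnSplit a b n
    σ = castSplit eq
    X-B : ∀ i j → castCols F eq (_∣ₘ_ F B R) i (left σ j) ≡ B i j
    X-B = Juxtaposed.left-cols (castCols-juxtaposed F eq B R)
    mono : ∀ i i′ → toℕ i < toℕ i′ → toℕ (left σ (p i)) < toℕ (left σ (p i′))
    mono i i′ i<i′ rewrite toℕ-castSplit-left eq (p i) | toℕ-castSplit-left eq (p i′) = p-mono i i′ i<i′
    before : ∀ i col → toℕ col < toℕ (left σ (p i)) → castCols F eq (_∣ₘ_ F B R) i col ≈ 0#
    before i col col<pᵢ rewrite toℕ-castSplit-left eq (p i) with covers σ col
    ... | inj₁ (j , ≡.refl) = trans (reflexive (X-B i j)) (before-p i j (≡.subst (_< toℕ (p i)) (toℕ-castSplit-left eq j) col<pᵢ))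
    ... | inj₂ (j , ≡.refl) = ⊥-elim (ℕ.<-irrefl ≡.refl (ℕ.≤-<-trans (ℕ.m≤m+n a (toℕ j))
            (ℕ.<-trans (≡.subst (_< toℕ (p i)) (toℕ-castSplit-right eq j) col<pᵢ) (Fin.toℕ<n (p i)))))

  juxtaposed-≈ₘ : ∀ {k a b n} {σ : ColumnSplit a b n} {X X′ : M k n} {L L′ : M k a} {R R′ : M k b} →
    Juxtaposed σ X L R → Juxtaposed σ X′ L′ R′ → _≈ₘ_ F X X′ → _≈ₘ_ F L L′ × _≈ₘ_ F R R′
  juxtaposed-≈ₘ {σ = σ} J J′ X≈X′ =
    (λ i j → trans (sym (reflexive (left-cols J i j))) (trans (X≈X′ i (left σ j)) (reflexive (left-cols J′ i j)))) ,
    (λ i j → trans (sym (reflexive (right-cols J i j))) (trans (X≈X′ i (right σ j)) (reflexive (right-cols J′ i j))))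
    where open Juxtaposed


module FiniteFieldRank {c ℓ : Level} (F : CommutativeRing c ℓ) {q : ℕ} (𝔽 : IsFiniteField F q) where
  open CommutativeRing F renaming (Carrier to K; _+_ to _⊹_; _*_ to _·_; zero to ·-zero)
  open import Algebra.Properties.Ring ring using (-‿distribˡ-*; -‿distribʳ-*; +-inverseˡ-unique; -‿involutive; -0#≈0#)
  open import Relation.Binary.Reasoning.Setoid setoid
  open LinearCombinations F

  private
    1≉0 : ¬ (1# ≈ 0#)
    1≉0 = proj₁ (proj₁ 𝔽)

    _⁻¹ : ∀ x → ¬ (x ≈ 0#) → ∃ λ y → x · y ≈ 1#
    _⁻¹ = proj₂ (proj₁ 𝔽)

    enum : Fin q → K
    enum = proj₁ (proj₁ (proj₂ 𝔽))

    enum-onto : ∀ x → ∃ λ i → enum i ≈ x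
    enum-onto = proj₁ (proj₂ (proj₁ (proj₂ 𝔽)))

    _≟_ : ∀ x y → Dec (x ≈ y)
    _≟_ = proj₂ (proj₂ 𝔽)

  -- Finiteness of F is used only here: membership in a row space is decided by trying all coefficient vectors.
  ∃?-K : ∀ {p} (P : K → Set p) → (∀ x → Dec (P x)) → (∀ {x y} → x ≈ y → P x → P y) → Dec (∃ P)
  ∃?-K P P? resp = map′ (λ (i , Peᵢ) → enum i , Peᵢ) from (Fin.any? (P? ∘ enum))
    where
    from : ∃ P → ∃ (P ∘ enum)
    from (x , Px) with enum-onto x
    ... | i , eᵢ≈x = i , resp (sym eᵢ≈x) Px

  ∃?-V : ∀ {p} m (P : V m → Set p) → (∀ v → Dec (P v)) → (∀ {u v} → (∀ i → u i ≈ v i) → P u → P v) → Dec (∃ P)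
  ∃?-V zero P P? resp = map′ (λ Pv → _ , Pv) (λ (v , Pv) → resp (λ ()) Pv) (P? (λ ()))
  ∃?-V (suc m) P P? resp =
    map′ (λ (x , v , Px∷v) → x ∷ v , Px∷v) (λ (v , Pv) → v zero , v ∘ suc , resp ∷-η Pv)
      (∃?-K (λ x → ∃ (P ∘ (x ∷_)))
            (λ x → ∃?-V m (P ∘ (x ∷_)) (P? ∘ (x ∷_)) (λ u≈v → resp λ { zero → refl ; (suc i) → u≈v i }))
            (λ x≈y (v , Px∷v) → v , resp (λ { zero → x≈y ; (suc i) → refl }) Px∷v))
    where
    ∷-η : ∀ {v : V (suc m)} i → v i ≈ (v zero ∷ v ∘ suc) i
    ∷-η zero = refl
    ∷-η (suc i) = refl

  rowSpace? : ∀ {m n} (X : M m n) v → Dec (rowSpace F X v)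
  rowSpace? {m} X v = ∃?-V m _ (λ a → Fin.all? (λ j → v j ≟ (a ⋆ X) j)) (λ a≈b v≈aX j → trans (v≈aX j) (⋆-congˡ X a≈b j))

  Indep-∷ : ∀ {m n} (w : V n) (Y : M m n) → Indep Y → ¬ rowSpace F Y w → Indep (w ∷ Y)
  Indep-∷ w Y indY w∉Y a a[w∷Y]≈0 = a≈0
    where
    r : V _
    r = (a ∘ suc) ⋆ Y
    a₀≈0 : a zero ≈ 0#
    a₀≈0 with a zero ≟ 0#
    ... | yes a₀≈0 = a₀≈0
    ... | no a₀≉0 with (a zero ⁻¹) a₀≉0
    ...   | y , a₀y≈1 = ⊥-elim (w∉Y ((λ l → - y · a (suc l)) , λ j → begin
      w j                   ≈⟨ *-identityˡ _ ⟨
      1# · w j              ≈⟨ *-congʳ (trans (sym a₀y≈1) (*-comm _ _)) ⟩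
      (y · a zero) · w j    ≈⟨ *-assoc _ _ _ ⟩
      y · (a zero · w j)    ≈⟨ *-congˡ (+-inverseˡ-unique _ _ (a[w∷Y]≈0 j)) ⟩
      y · - r j             ≈⟨ -‿distribʳ-* y (r j) ⟨
      - (y · r j)           ≈⟨ -‿distribˡ-* y (r j) ⟩
      - y · r j             ≈⟨ ⋆-scale (- y) (a ∘ suc) Y j ⟨
      ((λ l → - y · a (suc l)) ⋆ Y) j ∎))
    a≈0 : ∀ i → a i ≈ 0#
    a≈0 zero = a₀≈0
    a≈0 (suc l) = indY (a ∘ suc) (λ j → begin
      r j                       ≈⟨ +-identityˡ _ ⟨
      0# ⊹ r j                  ≈⟨ +-congʳ (trans (*-congʳ a₀≈0) (zeroˡ _)) ⟨
      a zero · w j ⊹ r j        ≈⟨ a[w∷Y]≈0 j ⟩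
      0#                        ∎) l

  record RowReduction {m n} (N : M m n) : Set (c ⊔ ℓ) where
    field
      nullity rank : ℕ
      nullity+rank≡m : nullity + rank ≡ m
      kernel : M nullity m
      kernel-indep : Indep kernel
      kernel-null : ∀ l j → (kernel l ⋆ N) j ≈ 0#
      image : M rank m
      image-indep : Indep (image *ₘ N)

  ⋆-0∷ : ∀ {m n} (g : V m) (N : M (suc m) n) j → ((0# ∷ g) ⋆ N) j ≈ (g ⋆ N ∘ suc) j
  ⋆-0∷ g N j = trans (+-congʳ (zeroˡ _)) (+-identityˡ _)

  private
    rowReduction-∈ : ∀ {m n} (N : M (suc m) n) (R : RowReduction (N ∘ suc)) →
      rowSpace F (RowReduction.image R *ₘ N ∘ suc) (N zero) → RowReduction N
    rowReduction-∈ N R (μ , N₀≈μHN) = record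
      { nullity+rank≡m = ≡.cong suc nullity+rank≡m
      ; kernel = g ∷ (λ l → 0# ∷ kernel l)
      ; kernel-indep = kernel-indep′
      ; kernel-null = λ { zero → g-null ; (suc l) j → trans (⋆-0∷ (kernel l) N j) (kernel-null l j) }
      ; image = λ l → 0# ∷ image l
      ; image-indep = Indep-resp (λ l j → sym (⋆-0∷ (image l) N j)) image-indep
      }
      where
      open RowReduction R
      g : V _
      g = 1# ∷ (λ i → - (μ ⋆ image) i)
      g-null : ∀ j → (g ⋆ N) j ≈ 0#
      g-null j = begin
        (g ⋆ N) j                                      ≈⟨ +-cong (*-identityˡ _) (⋆-neg (μ ⋆ image) (N ∘ suc) j) ⟩
        N zero j - ((μ ⋆ image) ⋆ N ∘ suc) j           ≈⟨ +-congʳ (trans (N₀≈μHN j) (⋆-assoc μ image (N ∘ suc) j)) ⟩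
        ((μ ⋆ image) ⋆ N ∘ suc) j - ((μ ⋆ image) ⋆ N ∘ suc) j  ≈⟨ -‿inverseʳ _ ⟩
        0#                                             ∎
      kernel-indep′ : Indep (g ∷ (λ l → 0# ∷ kernel l))
      kernel-indep′ a aK≈0 = a≈0
        where
        a₀≈0 : a zero ≈ 0#
        a₀≈0 = begin
          a zero                               ≈⟨ *-identityʳ _ ⟨
          a zero · 1#                          ≈⟨ +-identityʳ _ ⟨
          a zero · 1# ⊹ 0#                     ≈⟨ +-congˡ (Σᶠ-zero (λ l → zeroʳ (a (suc l)))) ⟨
          (a ⋆ (g ∷ (λ l → 0# ∷ kernel l))) zero ≈⟨ aK≈0 zero ⟩
          0#                                   ∎
        a≈0 : ∀ i → a i ≈ 0#
        a≈0 zero = a₀≈0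
        a≈0 (suc l) = kernel-indep (a ∘ suc) (λ i → begin
          ((a ∘ suc) ⋆ kernel) i                 ≈⟨ +-identityˡ _ ⟨
          0# ⊹ ((a ∘ suc) ⋆ kernel) i            ≈⟨ +-congʳ (trans (*-congʳ a₀≈0) (zeroˡ _)) ⟨
          a zero · g (suc i) ⊹ ((a ∘ suc) ⋆ kernel) i ≈⟨ aK≈0 (suc i) ⟩
          0#                                     ∎) l

    rowReduction-∉ : ∀ {m n} (N : M (suc m) n) (R : RowReduction (N ∘ suc)) →
      ¬ rowSpace F (RowReduction.image R *ₘ N ∘ suc) (N zero) → RowReduction N
    rowReduction-∉ N R N₀∉HN = record
      { nullity+rank≡m = ≡.trans (ℕ.+-suc nullity rank) (≡.cong suc nullity+rank≡m)
      ; kernel = λ l → 0# ∷ kernel l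
      ; kernel-indep = λ a aK≈0 → kernel-indep a (aK≈0 ∘ suc)
      ; kernel-null = λ l j → trans (⋆-0∷ (kernel l) N j) (kernel-null l j)
      ; image = image′
      ; image-indep = Indep-resp image-rows (Indep-∷ (N zero) (image *ₘ N ∘ suc) image-indep N₀∉HN)
      }
      where
      open RowReduction R
      image′ : M (suc rank) _
      image′ = (1# ∷ λ _ → 0#) ∷ (λ l → 0# ∷ image l)
      image-rows : ∀ l j → (N zero ∷ image *ₘ N ∘ suc) l j ≈ (image′ l ⋆ N) j
      image-rows zero j = sym (trans (+-cong (*-identityˡ _) (⋆-zeroˡ (N ∘ suc) (λ _ → refl) j)) (+-identityʳ _))
      image-rows (suc l) j = sym (⋆-0∷ (image l) N j)

  rowReduction : ∀ {m n} (N : M m n) → RowReduction N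
  rowReduction {zero} N = record
    { nullity = 0 ; rank = 0 ; nullity+rank≡m = ≡.refl
    ; kernel = λ () ; kernel-indep = λ _ _ () ; kernel-null = λ ()
    ; image = λ () ; image-indep = λ _ _ () }
  rowReduction {suc m} N with rowReduction (N ∘ suc)
  ... | R with rowSpace? (RowReduction.image R *ₘ N ∘ suc) (N zero)
  ...   | yes N₀∈HN = rowReduction-∈ N R N₀∈HN
  ...   | no N₀∉HN = rowReduction-∉ N R N₀∉HN

  Indep-supported-on-zero : ∀ {κ n} (Z : M κ (suc n)) → Indep Z → (∀ l j → Z l (suc j) ≈ 0#) → κ ≤ 1
  Indep-supported-on-zero {zero} Z _ _ = z≤n
  Indep-supported-on-zero {suc zero} Z _ _ = s≤s z≤n
  Indep-supported-on-zero {suc (suc κ)} Z indZ Z≈0 = ⊥-elim (1≉0 (indZ (1# ∷ λ _ → 0#) Z₀-null zero))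
    where
    -- With Z₀ = (u, 0, …) and Z₁ = (w, 0, …), the combination w Z₀ − u Z₁ vanishes, forcing u ≈ 0 and Z₀ ≈ 0.
    u w : K
    u = Z zero zero
    w = Z (suc zero) zero
    e : V (suc (suc κ))
    e = w ∷ - u ∷ λ _ → 0#
    e-null : ∀ col → (e ⋆ Z) col ≈ 0#
    e-null zero = begin
      w · u ⊹ (- u · w ⊹ Σᶠ F (λ l → 0# · Z (suc (suc l)) zero))
        ≈⟨ +-congˡ (+-congˡ (Σᶠ-zero {f = λ l → 0# · Z (suc (suc l)) zero} (λ l → zeroˡ _))) ⟩
      w · u ⊹ (- u · w ⊹ 0#)                                       ≈⟨ +-congˡ (trans (+-identityʳ _) (sym (-‿distribˡ-* u w))) ⟩
      w · u ⊹ - (u · w)                                            ≈⟨ +-congˡ (-‿cong (*-comm u w)) ⟩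
      w · u - w · u                                                ≈⟨ -‿inverseʳ _ ⟩
      0#                                                           ∎
    e-null (suc j) = ⋆-zeroʳ e {Z} (suc j) (λ l → Z≈0 l j)
    u≈0 : u ≈ 0#
    u≈0 = trans (sym (-‿involutive u)) (trans (-‿cong (indZ e e-null (suc zero))) -0#≈0#)
    Z₀-null : ∀ col → ((1# ∷ λ _ → 0#) ⋆ Z) col ≈ 0#
    Z₀-null col = begin
      1# · Z zero col ⊹ Σᶠ F (λ l → 0# · Z (suc l) col)
        ≈⟨ +-cong (*-identityˡ _) (Σᶠ-zero {f = λ l → 0# · Z (suc l) col} (λ l → zeroˡ _)) ⟩
      Z zero col ⊹ 0#                                     ≈⟨ +-identityʳ _ ⟩
      Z zero col                                          ≈⟨ Z₀≈0 col ⟩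
      0#                                                  ∎
      where
      Z₀≈0 : ∀ col → Z zero col ≈ 0#
      Z₀≈0 zero = u≈0
      Z₀≈0 (suc j) = Z≈0 zero j

  Indep⇒≤ : ∀ {m n} (X : M m n) → Indep X → m ≤ n
  Indep⇒≤ {zero} X _ = z≤n
  Indep⇒≤ {suc m} {zero} X indX = ⊥-elim (1≉0 (indX (λ _ → 1#) (λ ()) zero))
  Indep⇒≤ {suc m} {suc n} X indX = ≡.subst (_≤ suc n) nullity+rank≡m
    (ℕ.+-mono-≤ (Indep-supported-on-zero (kernel *ₘ X) (Indep-*ₘ {X = X} kernel-indep indX) kernel-null)
                (Indep⇒≤ (image *ₘ X′) image-indep))
    where
    X′ : M (suc m) n
    X′ i j = X i (suc j)
    open RowReduction (rowReduction X′)

  ¬DimAtLeast-suc : ∀ {n} {S : Sub F n} → ¬ DimAtLeast F S (suc n)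
  ¬DimAtLeast-suc (vs , _ , indVs) = ℕ.<-irrefl ≡.refl (Indep⇒≤ vs indVs)

  DimAtLeast⇒≤ : ∀ {n} {S : Sub F n} {d e} → DimAtLeast F S d → ¬ DimAtLeast F S (suc e) → d ≤ e
  DimAtLeast⇒≤ {S = S} {d} {e} dimS ¬dimS with d ℕ.≤? e
  ... | yes d≤e = d≤e
  ... | no d≰e = ⊥-elim (¬dimS (DimAtLeast-≤ {S = S} (ℕ.≰⇒> d≰e) dimS))

  -- Only doubly negated: DimAtLeast F S d need not be decidable for an arbitrary predicate S.
  ¬¬-HasDim : ∀ {n} (S : Sub F n) → ¬ ¬ ∃ (HasDim F S)
  ¬¬-HasDim {n} S ¬hasDim = climb n 0 ≡.refl ((λ ()) , (λ ()) , (λ _ _ ()))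
    where
    climb : ∀ g d → d + g ≡ n → DimAtLeast F S d → ⊥
    climb zero d d+0≡n dimS = ¬hasDim (d , dimS ,
      ≡.subst (λ e → ¬ DimAtLeast F S (suc e)) (≡.trans (≡.sym d+0≡n) (ℕ.+-identityʳ d)) (¬DimAtLeast-suc {S = S}))
    climb (suc g) d d+g≡n dimS = ¬hasDim (d , dimS , climb g (suc d) (≡.trans (≡.sym (ℕ.+-suc d g)) d+g≡n))

  nullity≥ : ∀ {m n} (N : M m n) {u e} → RankAtMost F N u → e + u ≤ m → DimAtLeast F (LeftKernel N) e
  nullity≥ {m} N {u} {e} rank≤u e+u≤m =
    DimAtLeast-≤ {S = LeftKernel N} e≤nullity (kernel , (λ l → lift (kernel-null l)) , kernel-indep)
    where
    open RowReduction (rowReduction N)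
    rank≤u′ : rank ≤ u
    rank≤u′ = DimAtLeast⇒≤ {S = rowSpace F N} (image *ₘ N , (λ l → image l , λ _ → refl) , image-indep) rank≤u
    e≤nullity : e ≤ nullity
    e≤nullity = ℕ.+-cancelʳ-≤ u e nullity
      (ℕ.≤-trans e+u≤m (≡.subst (_≤ nullity + u) nullity+rank≡m (ℕ.+-monoʳ-≤ nullity rank≤u′)))

  nullity+rank≤ : ∀ {m n} (N : M m n) {b h} → DimAtLeast F (LeftKernel N) b → RankAtLeast F N h → b + h ≤ m
  nullity+rank≤ {m} N {h = h} (xs , xs∈ker , ind-xs) (ws , ws∈N , ind-ws) = Indep⇒≤ (xs ++ ys) (Indep-++ xs ys independent)
    where
    ys : M h m
    ys l = proj₁ (ws∈N l)
    ws≈ysN : ∀ l j → ws l j ≈ (ys l ⋆ N) j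
    ws≈ysN l = proj₂ (ws∈N l)
    independent : ∀ α β → (∀ j → (α ⋆ xs) j ⊹ (β ⋆ ys) j ≈ 0#) → (∀ i → α i ≈ 0#) × (∀ i → β i ≈ 0#)
    independent α β αxs+βys≈0 = α≈0 , β≈0
      where
      β≈0 : ∀ i → β i ≈ 0#
      β≈0 = ind-ws β (λ j → begin
        (β ⋆ ws) j                                   ≈⟨ trans (⋆-congʳ β ws≈ysN j) (⋆-assoc β ys N j) ⟩
        ((β ⋆ ys) ⋆ N) j                             ≈⟨ +-identityˡ _ ⟨
        0# ⊹ ((β ⋆ ys) ⋆ N) j
          ≈⟨ +-congʳ (trans (sym (⋆-assoc α xs N j)) (⋆-zeroʳ α {xs *ₘ N} j (λ l → lower (xs∈ker l) j))) ⟨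
        ((α ⋆ xs) ⋆ N) j ⊹ ((β ⋆ ys) ⋆ N) j          ≈⟨ ⋆-distribʳ-⊹ (α ⋆ xs) (β ⋆ ys) N j ⟨
        ((λ i → (α ⋆ xs) i ⊹ (β ⋆ ys) i) ⋆ N) j      ≈⟨ ⋆-zeroˡ N αxs+βys≈0 j ⟩
        0#                                           ∎)
      α≈0 : ∀ i → α i ≈ 0#
      α≈0 = ind-xs α (λ i → trans (sym (+-identityʳ _)) (trans (+-congˡ (sym (⋆-zeroˡ ys β≈0 i))) (αxs+βys≈0 i)))

  commonKernel : ∀ {k a t} (R : M k a) (B : M k t) {h u} → RankAtMost F R u → h + t + u ≤ k →
    DimAtLeast F (_∩_ F (LeftKernel R) (LeftKernel B)) h
  commonKernel R B {h} {u} rank≤u h+t+u≤k with nullity≥ R rank≤u h+t+u≤k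
  ... | A₁ , A₁∈ker , ind-A₁ with nullity≥ (A₁ *ₘ B) (¬DimAtLeast-suc {S = rowSpace F (A₁ *ₘ B)}) ℕ.≤-refl
  ...   | A₂ , A₂∈ker , ind-A₂ =
    A₂ *ₘ A₁ , (λ l → via-A₁ R (R-null l) , via-A₁ B (lower (A₂∈ker l))) , Indep-*ₘ {G = A₂} {X = A₁} ind-A₂ ind-A₁
    where
    via-A₁ : ∀ {n} (N : M _ n) {l} → (∀ j → (A₂ l ⋆ A₁ *ₘ N) j ≈ 0#) → LeftKernel N ((A₂ *ₘ A₁) l)
    via-A₁ N {l} null = lift (λ j → trans (sym (⋆-assoc (A₂ l) A₁ N j)) (null j))
    R-null : ∀ l j → (A₂ l ⋆ A₁ *ₘ R) j ≈ 0#
    R-null l j = ⋆-zeroʳ (A₂ l) {A₁ *ₘ R} j (λ i → lower (A₁∈ker i) j)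

module LiftedCodes {c ℓ : Level} (F : CommutativeRing c ℓ) {q : ℕ} (𝔽 : IsFiniteField F q) where
  open CommutativeRing F renaming (Carrier to K; _+_ to _⊹_; _*_ to _·_; zero to ·-zero)
  open import Algebra.Properties.Ring ring using (x∙y⁻¹≈ε⇒x≈y; x≈y⇒x∙y⁻¹≈ε)
  open import Relation.Binary.Reasoning.Setoid setoid
  open LinearCombinations F
  open FiniteFieldRank F 𝔽
  open ColumnSplit

  DimAtLeast-∩-unitRows : ∀ {k s t a n h u} {X : M k n} {B : M k (s + t)} {R : M k a} {W : M s n}
    (σ : ColumnSplit (s + t) a n) → Juxtaposed σ X B R → (U : UnitRows W) →
    (∀ i → UnitRows.pivot U i ≡ left σ (right (tailSplit s t) i)) →
    Indep B → RankAtMost F R u → h + t + u ≤ k →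
    DimAtLeast F (_∩_ F (rowSpace F W) (rowSpace F X)) h
  DimAtLeast-∩-unitRows {t = t} {h = h} {X = X} {B} {R} {W} σ J U pivot≡ indB rank≤u h+t+u≤k =
    toMeet (commonKernel R (firstCols t B) rank≤u h+t+u≤k)
    where
    toMeet : DimAtLeast F (_∩_ F (LeftKernel R) (LeftKernel (firstCols t B))) h →
             DimAtLeast F (_∩_ F (rowSpace F W) (rowSpace F X)) h
    toMeet (A , A∈ker , indA) =
      A *ₘ X ,
      (λ l → UnitRows.span U (A l ⋆ X) (vanish-off-pivots σ J U pivot≡ (proj₁ (A∈ker l)) (proj₂ (A∈ker l))) , (A l , λ _ → refl)) ,
      Indep-*ₘ {X = X} indA (Indep-columns X B (left σ) (λ i c → reflexive (Juxtaposed.left-cols J i c)) indB)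

  module _ {k a b n : ℕ} (σ : ColumnSplit b a n) where

    DimAtLeast-∩-restrict : ∀ {e} {X X′ : M k n} {B B′ : M k b} {R R′ : M k a} →
      Juxtaposed σ X B R → Juxtaposed σ X′ B′ R′ → Indep B →
      DimAtLeast F (_∩_ F (rowSpace F X) (rowSpace F X′)) e → DimAtLeast F (_∩_ F (rowSpace F B) (rowSpace F B′)) e
    DimAtLeast-∩-restrict {X = X} {X′} {B} J J′ indB (zs , zs∈ , indZs) =
      (λ l → zs l ∘ left σ) ,
      (λ l → (xs l , λ c → trans (zs≈xsX l (left σ c)) (⋆-left J (xs l) c)) ,
             (xs′ l , λ c → trans (zs≈xs′X′ l (left σ c)) (⋆-left J′ (xs′ l) c))) ,
      Indep-resp (λ l c → sym (trans (zs≈xsX l (left σ c)) (⋆-left J (xs l) c)))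
                 (Indep-*ₘ {X = B} (Indep-coefficients xs X zs≈xsX indZs) indB)
      where
      xs xs′ : M _ k
      xs l = proj₁ (proj₁ (zs∈ l))
      xs′ l = proj₁ (proj₂ (zs∈ l))
      zs≈xsX : ∀ l j → zs l j ≈ (xs l ⋆ X) j
      zs≈xsX l = proj₂ (proj₁ (zs∈ l))
      zs≈xs′X′ : ∀ l j → zs l j ≈ (xs′ l ⋆ X′) j
      zs≈xs′X′ l = proj₂ (proj₂ (zs∈ l))

    DimAtLeast-⊕-extend : ∀ {e} {X X′ : M k n} {B B′ : M k b} {R R′ : M k a} →
      Juxtaposed σ X B R → Juxtaposed σ X′ B′ R′ →
      DimAtLeast F (_⊕_ F (rowSpace F B) (rowSpace F B′)) e → DimAtLeast F (_⊕_ F (rowSpace F X) (rowSpace F X′)) e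
    DimAtLeast-⊕-extend {X = X} {X′} {B} {B′} J J′ (ys , ys∈ , indYs) =
      proj₁ ∘ extend ∘ ys∈ , proj₁ ∘ proj₂ ∘ extend ∘ ys∈ ,
      Indep-columns (proj₁ ∘ extend ∘ ys∈) ys (left σ) (proj₂ ∘ proj₂ ∘ extend ∘ ys∈) indYs
      where
      extend : ∀ {y} → _⊕_ F (rowSpace F B) (rowSpace F B′) y →
        Σ (V n) λ ŷ → _⊕_ F (rowSpace F X) (rowSpace F X′) ŷ × (∀ c → ŷ (left σ c) ≈ y c)
      extend (u , u′ , (α , u≈αB) , (β , u′≈βB′) , y≈u+u′) =
        (λ col → (α ⋆ X) col ⊹ (β ⋆ X′) col) , (_ , _ , (α , λ _ → refl) , (β , λ _ → refl) , λ _ → refl) ,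
        λ c → sym (trans (y≈u+u′ c) (+-cong (trans (u≈αB c) (sym (⋆-left J α c)))
                                             (trans (u′≈βB′ c) (sym (⋆-left J′ β c)))))

    DimAtLeast-∩⇒LeftKernel : ∀ {e} {X X′ : M k n} {B : M k b} {R R′ : M k a} →
      Juxtaposed σ X B R → Juxtaposed σ X′ B R′ → Indep B →
      DimAtLeast F (_∩_ F (rowSpace F X) (rowSpace F X′)) e → DimAtLeast F (LeftKernel (_-ₘ_ F R R′)) e
    DimAtLeast-∩⇒LeftKernel {X = X} {X′} {B} {R} {R′} J J′ indB (zs , zs∈ , indZs) =
      xs , (λ l → lift (in-kernel (proj₁ (zs∈ l)) (proj₂ (zs∈ l)))) ,
      Indep-coefficients xs X (λ l → proj₂ (proj₁ (zs∈ l))) indZs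
      where
      xs : M _ k
      xs l = proj₁ (proj₁ (zs∈ l))
      in-kernel : ∀ {z} (z∈X : rowSpace F X z) → rowSpace F X′ z → ∀ j → (proj₁ z∈X ⋆ _-ₘ_ F R R′) j ≈ 0#
      in-kernel (x , z≈xX) (x′ , z≈x′X′) j = trans (⋆-distribˡ--ₘ x R R′ j) (x≈y⇒x∙y⁻¹≈ε (begin
        (x ⋆ R) j             ≈⟨ ⋆-right J x j ⟨
        (x ⋆ X) (right σ j)   ≈⟨ trans (sym (z≈xX (right σ j))) (z≈x′X′ (right σ j)) ⟩
        (x′ ⋆ X′) (right σ j) ≈⟨ ⋆-right J′ x′ j ⟩
        (x′ ⋆ R′) j           ≈⟨ ⋆-congˡ R′ x≈x′ j ⟨
        (x ⋆ R′) j            ∎))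
        where
        xB≈x′B : ∀ c → (x ⋆ B) c ≈ (x′ ⋆ B) c
        xB≈x′B c = begin
          (x ⋆ B) c            ≈⟨ ⋆-left J x c ⟨
          (x ⋆ X) (left σ c)   ≈⟨ trans (sym (z≈xX (left σ c))) (z≈x′X′ (left σ c)) ⟩
          (x′ ⋆ X′) (left σ c) ≈⟨ ⋆-left J′ x′ c ⟩
          (x′ ⋆ B) c           ∎
        x≈x′ : ∀ i → x i ≈ x′ i
        x≈x′ i = x∙y⁻¹≈ε⇒x≈y _ _
          (indB (λ i → x i - x′ i) (λ c → trans (⋆-distribʳ-- x x′ B c) (x≈y⇒x∙y⁻¹≈ε (xB≈x′B c))) i)

    DimAtLeast-⊕-rank : ∀ {h} {X X′ : M k n} {B : M k b} {R R′ : M k a} →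
      Juxtaposed σ X B R → Juxtaposed σ X′ B R′ → Indep B →
      RankAtLeast F (_-ₘ_ F R R′) h → DimAtLeast F (_⊕_ F (rowSpace F X) (rowSpace F X′)) (k + h)
    DimAtLeast-⊕-rank {h} {X} {X′} {B} {R} {R′} J J′ indB (ws , ws∈D , indWs) =
      X ++ ŵ , ∀-++ (_⊕_ F (rowSpace F X) (rowSpace F X′)) X ŵ X-rows∈ ŵ∈ , Indep-++ X ŵ independent
      where
      ys : M h k
      ys m = proj₁ (ws∈D m)
      ŵ : M h n
      ŵ m col = (ys m ⋆ X) col - (ys m ⋆ X′) col
      X-rows∈ : ∀ i → _⊕_ F (rowSpace F X) (rowSpace F X′) (X i)
      X-rows∈ i = X i , (λ _ → 0#) , row∈rowSpace X i , ((λ _ → 0#) , λ col → sym (⋆-zeroˡ X′ (λ _ → refl) col)) ,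
                  λ col → sym (+-identityʳ _)
      ŵ∈ : ∀ m → _⊕_ F (rowSpace F X) (rowSpace F X′) (ŵ m)
      ŵ∈ m = ys m ⋆ X , (λ col → - (ys m ⋆ X′) col) , (ys m , λ _ → refl) ,
             ((λ i → - ys m i) , λ col → sym (⋆-neg (ys m) X′ col)) , λ _ → refl
      ŵ-left : ∀ m c → ŵ m (left σ c) ≈ 0#
      ŵ-left m c = x≈y⇒x∙y⁻¹≈ε (trans (⋆-left J (ys m) c) (sym (⋆-left J′ (ys m) c)))
      ŵ-right : ∀ m j → ŵ m (right σ j) ≈ ws m j
      ŵ-right m j = begin
        (ys m ⋆ X) (right σ j) - (ys m ⋆ X′) (right σ j) ≈⟨ +-cong (⋆-right J (ys m) j) (-‿cong (⋆-right J′ (ys m) j)) ⟩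
        (ys m ⋆ R) j - (ys m ⋆ R′) j                     ≈⟨ ⋆-distribˡ--ₘ (ys m) R R′ j ⟨
        (ys m ⋆ _-ₘ_ F R R′) j                           ≈⟨ proj₂ (ws∈D m) j ⟨
        ws m j                                           ∎
      independent : ∀ α β → (∀ col → (α ⋆ X) col ⊹ (β ⋆ ŵ) col ≈ 0#) → (∀ i → α i ≈ 0#) × (∀ m → β m ≈ 0#)
      independent α β αX+βŵ≈0 = α≈0 , β≈0
        where
        α≈0 : ∀ i → α i ≈ 0#
        α≈0 = indB α (λ c → begin
          (α ⋆ B) c                                  ≈⟨ ⋆-left J α c ⟨
          (α ⋆ X) (left σ c)                         ≈⟨ +-identityʳ _ ⟨
          (α ⋆ X) (left σ c) ⊹ 0#                    ≈⟨ +-congˡ (⋆-zeroʳ β {ŵ} (left σ c) (λ m → ŵ-left m c)) ⟨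
          (α ⋆ X) (left σ c) ⊹ (β ⋆ ŵ) (left σ c)    ≈⟨ αX+βŵ≈0 (left σ c) ⟩
          0#                                         ∎)
        β≈0 : ∀ m → β m ≈ 0#
        β≈0 = indWs β (λ j → begin
          (β ⋆ ws) j                                 ≈⟨ Σᶠ-cong (λ m → *-congˡ (ŵ-right m j)) ⟨
          (β ⋆ ŵ) (right σ j)                        ≈⟨ +-identityˡ _ ⟨
          0# ⊹ (β ⋆ ŵ) (right σ j)                   ≈⟨ +-congʳ (⋆-zeroˡ X α≈0 (right σ j)) ⟨
          (α ⋆ X) (right σ j) ⊹ (β ⋆ ŵ) (right σ j)  ≈⟨ αX+βŵ≈0 (right σ j) ⟩
          0#                                         ∎)

    subDist-sameB : ∀ {h} {X X′ : M k n} {B : M k b} {R R′ : M k a} →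
      Juxtaposed σ X B R → Juxtaposed σ X′ B R′ → Indep B → RankAtLeast F (_-ₘ_ F R R′) h →
      SubDistAtLeast F (rowSpace F X) (rowSpace F X′) (h + h)
    subDist-sameB {h} {X} {X′} {B} {R} {R′} J J′ indB rank≥h _ _ (_ , sum≱) (meet≥b , _) =
      +-double-≤ (nullity+rank≤ (_-ₘ_ F R R′) (DimAtLeast-∩⇒LeftKernel J J′ indB meet≥b) rank≥h)
                 (DimAtLeast⇒≤ {S = _⊕_ F (rowSpace F X) (rowSpace F X′)} (DimAtLeast-⊕-rank J J′ indB rank≥h) sum≱)

    subDist-restrict : ∀ {d} {X X′ : M k n} {B B′ : M k b} {R R′ : M k a} →
      Juxtaposed σ X B R → Juxtaposed σ X′ B′ R′ → Indep B →
      SubDistAtLeast F (rowSpace F B) (rowSpace F B′) d → SubDistAtLeast F (rowSpace F X) (rowSpace F X′) d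
    subDist-restrict {d} {X} {X′} {B} {B′} J J′ indB distB dimSum dimMeet (_ , sum≱) (meet≥b , _) =
      decidable-stable (d + dimMeet ℕ.≤? dimSum) λ d+b≰a →
        ¬¬-HasDim SumB (λ (a′ , hasDim-a′) → ¬¬-HasDim MeetB (λ (b′ , hasDim-b′) →
          d+b≰a (ℕ.≤-trans (ℕ.+-monoʳ-≤ d (DimAtLeast⇒≤ {S = MeetB} (DimAtLeast-∩-restrict J J′ indB meet≥b) (proj₂ hasDim-b′)))
                 (ℕ.≤-trans (distB a′ b′ hasDim-a′ hasDim-b′)
                            (DimAtLeast⇒≤ {S = _⊕_ F (rowSpace F X) (rowSpace F X′)}
                                          (DimAtLeast-⊕-extend J J′ (proj₁ hasDim-a′)) sum≱)))))
      where
      SumB MeetB : Sub F b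
      SumB = _⊕_ F (rowSpace F B) (rowSpace F B′)
      MeetB = _∩_ F (rowSpace F B) (rowSpace F B′)

  DimAtLeast-∩-zeroId : ∀ {k r s t u h} (t≤r : t ≤ r) (R : M k (r ∸ t)) (B : M k (s + t)) →
    IsRREF F B → RankAtMost F R u → h + t + u ≤ k →
    DimAtLeast F (_∩_ F (rowSpace F (zeroId F r s)) (rowSpace F (castCols F (colEq r s t t≤r) (_∣ₘ_ F R B)))) h
  DimAtLeast-∩-zeroId {r = r} {s} {t} t≤r R B rref =
    DimAtLeast-∩-unitRows (swapSplit (castSplit {r ∸ t} {s + t} (colEq r s t t≤r)))
      (swapJuxtaposed (castCols-juxtaposed F (colEq r s t t≤r) R B))
      (zeroId-unitRows r s) (↑ʳ≡right∘right t≤r) (IsRREF⇒Indep B rref)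

  module _ {r s t : ℕ} (t≤r : t ≤ r) where

    private
      layout : s + t + (r ∸ t) ≡ r + s
      layout = ≡.trans (ℕ.+-assoc s t (r ∸ t)) (≡.trans (≡.cong (s +_) (ℕ.m+[n∸m]≡n t≤r)) (ℕ.+-comm s r))

      σ : ColumnSplit (s + t) (r ∸ t) (r + s)
      σ = castSplit layout

      pivot : Fin s → Fin (r + s)
      pivot i = left σ (right (tailSplit s t) i)

      toℕ-pivot : ∀ i → toℕ (pivot i) ≡ t + toℕ i
      toℕ-pivot i = ≡.trans (toℕ-castSplit-left {s + t} {r ∸ t} layout _) (toℕ-castSplit-right (ℕ.+-comm t s) i)

      pivot-injective : ∀ {i i′} → pivot i ≡ pivot i′ → i ≡ i′
      pivot-injective {i} {i′} eq = Fin.toℕ-injective (ℕ.+-cancelˡ-≡ t _ _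
        (≡.trans (≡.sym (toℕ-pivot i)) (≡.trans (≡.cong toℕ eq) (toℕ-pivot i′))))

      pivot-mono : ∀ i i′ → toℕ i < toℕ i′ → toℕ (pivot i) < toℕ (pivot i′)
      pivot-mono i i′ i<i′ rewrite toℕ-pivot i | toℕ-pivot i′ = ℕ.+-monoʳ-< t i<i′

    -- The statement's (R ∣ τ(B)) is not in reduced row echelon form, but (τ(B) ∣ R) is.
    liftCode : ∀ {k} → M k (s + t) → M k (r ∸ t) → M k (r + s)
    liftCode B R = castCols F layout (_∣ₘ_ F B R)

    liftedCode : ∀ {k d u nB nR} → 2 ∣ d → d / 2 + t + u ≤ k →
      (𝓑 : Fin nB → M k (s + t)) → IsCDC F (s + t) nB d k 𝓑 →
      (𝓡 : Fin nR → M k (r ∸ t)) → IsRankCode F k (r ∸ t) (d / 2) u nR 𝓡 →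
      Σ (Fin (nB * nR) → M k (r + s)) λ 𝓒 → IsCDC F (r + s) (nB * nR) d k 𝓒 × HasBSubspace F (r + s) s d k (nB * nR) 𝓒
    liftedCode {k} {d} {nB = nB} {nR} 2∣d h+t+u≤k 𝓑 (𝓑-rref , 𝓑-distinct , 𝓑-dist) 𝓡 (𝓡-distinct , 𝓡-dist , 𝓡-rank) =
      𝓒 , (rref ∘ index , on-index distinct , on-index dist) , (unitMatrix pivot , unitMatrix-isRREF pivot pivot-injective pivot-mono , meet)
      where
      index : Fin (nB * nR) → Fin nB × Fin nR
      index = Fin.remQuot {nB} nR
      code : Fin nB × Fin nR → M k (r + s)
      code (j , i) = liftCode (𝓑 j) (𝓡 i)
      𝓒 : Fin (nB * nR) → M k (r + s)
      𝓒 = code ∘ index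
      on-index : ∀ {p} {P : Fin nB × Fin nR → Fin nB × Fin nR → Set p} →
        (∀ p p′ → p ≢ p′ → P p p′) → ∀ x y → x ≢ y → P (index x) (index y)
      on-index P≢ x y x≢y = P≢ (index x) (index y) (x≢y ∘ remQuot-injective {nB} nR)
      J : ∀ j i → Juxtaposed σ (code (j , i)) (𝓑 j) (𝓡 i)
      J j i = castCols-juxtaposed F layout (𝓑 j) (𝓡 i)
      rref : ∀ p → IsRREF F (code p)
      rref (j , i) = IsRREF-castCols layout (𝓑 j) (𝓡 i) (𝓑-rref j)
      meet : ∀ x → DimAtLeast F (_∩_ F (rowSpace F (unitMatrix pivot)) (rowSpace F (𝓒 x))) (d / 2)
      meet x = DimAtLeast-∩-unitRows σ (J _ _) (unitMatrix-unitRows pivot pivot-injective) (λ _ → ≡.refl)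
                 (IsRREF⇒Indep _ (𝓑-rref _)) (𝓡-rank _) h+t+u≤k
      distinct : ∀ p p′ → p ≢ p′ → ¬ _≈ₘ_ F (code p) (code p′)
      distinct (j , i) (j′ , i′) p≢p′ code≈ with ×-≢ Fin._≟_ p≢p′
      ... | inj₁ j≢j′ = 𝓑-distinct j j′ j≢j′ (proj₁ (juxtaposed-≈ₘ (J j i) (J j′ i′) code≈))
      ... | inj₂ (_ , i≢i′) = 𝓡-distinct i i′ i≢i′ (proj₂ (juxtaposed-≈ₘ (J j i) (J j′ i′) code≈))
      dist : ∀ p p′ → p ≢ p′ → SubDistAtLeast F (rowSpace F (code p)) (rowSpace F (code p′)) d
      dist (j , i) (j′ , i′) p≢p′ with ×-≢ Fin._≟_ p≢p′
      ... | inj₁ j≢j′ = subDist-restrict σ (J j i) (J j′ i′) (IsRREF⇒Indep _ (𝓑-rref j)) (𝓑-dist j j′ j≢j′)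
      ... | inj₂ (≡.refl , i≢i′) =
        ≡.subst (SubDistAtLeast F (rowSpace F (code (j , i))) (rowSpace F (code (j , i′)))) (half+half 2∣d)
          (subDist-sameB σ (J j i) (J j i′) (IsRREF⇒Indep _ (𝓑-rref j)) (𝓡-dist i i′ i≢i′))

lemma26 : {c ℓ : Level} (F : CommutativeRing c ℓ) (q : ℕ) →
    IsPrimePower q → IsFiniteField F q →
    (d k r s t : ℕ) → 2 ∣ d → 2 ≤ d / 2 → d / 2 ≤ k → k ≤ s + t →
    t ≤ k ∸ d / 2 → (t≤r : t ≤ r) →
    ((NB : ℕ) (𝓑 : Fin NB → Mat F k (s + t)) → IsCDC F (s + t) NB d k 𝓑 →
     (NR : ℕ) (𝓡 : Fin NR → Mat F k (r ∸ t)) →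
     IsRankCode F k (r ∸ t) (d / 2) (k ∸ d / 2 ∸ t) NR 𝓡 →
     (i : Fin NR) (j : Fin NB) →
     DimAtLeast F
       (_∩_ F (rowSpace F (zeroId F r s))
              (rowSpace F (castCols F (colEq r s t t≤r) (_∣ₘ_ F (𝓡 i) (𝓑 j)))))
       (d / 2))
    ×
    ((nA nΛ nB : ℕ) → IsAq F (s + t) d k nA →
     IsΛ F k (r ∸ t) (d / 2) (k ∸ d / 2 ∸ t) nΛ →
     IsBq F (r + s) s d k nB → nA * nΛ ≤ nB)
lemma26 F q _ 𝔽 d k r s t 2∣d _ d/2≤k _ t≤k∸d/2 t≤r =
  (λ _ 𝓑 (𝓑-rref , _) _ 𝓡 (_ , _ , 𝓡-rank) i j → DimAtLeast-∩-zeroId t≤r (𝓡 i) (𝓑 j) (𝓑-rref j) (𝓡-rank i) fits) ,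
  (λ nA nΛ _ ((𝓑 , 𝓑-cdc) , _) ((𝓡 , 𝓡-code) , _) (_ , nB-max) →
    let 𝓒 , 𝓒-cdc , 𝓒-W = liftedCode t≤r 2∣d fits 𝓑 𝓑-cdc 𝓡 𝓡-code in nB-max (nA * nΛ) 𝓒 𝓒-cdc 𝓒-W)
  where
  open LiftedCodes F 𝔽
  fits : d / 2 + t + (k ∸ d / 2 ∸ t) ≤ k
  fits = ℕ.≤-reflexive (m+n+[o∸m∸n]≡o d/2≤k t≤k∸d/2)
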